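{- Let $\chi$ be a coloring of the pairs of $[N]$ with integer colors, and let $S=\{v_1,\dots,v_s\}\subset[N]$ with $v_1<\dots<v_s$ be a non-increasing set with respect to $\chi$. Fix $v_j\in S$. Then for any $v_i,v_\ell\in S$ with $v_i<v_j<v_\ell$: (1) $\chi(v_i,v_j)\ge \chi(v_j,v_\ell)$; (2) $\chi(v_{j-1},v_j)\le \chi(v_i,v_j)$; (3) $\chi(v_j,v_{j+1})\ge \chi(v_j,v_\ell)$.
   Context: Let $\chi$ be a coloring of the pairs of $[N]=\{1,\dots,N\}$ with colors from a finite set of integers $\kappa_1<\dots<\kappa_q$. A triple $u<v<w$ in $[N]$ is non-increasing if either $\chi(u,v)=\chi(u,w)\ge \chi(v,w)$, or $\chi(u,v)\ge\chi(v,w)=\chi(u,w)$. A set $S\subset[N]$ is non-increasing with respect to $\chi$ if every triple in $S$ is non-increasing. -}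

module Defs where

open import Data.Nat using (ℕ; _<_; _≤_)
open import Data.Integer using (ℤ) renaming (_≤_ to _≤ℤ_)
open import Data.Product using (_×_)
open import Data.Sum using (_⊎_)
open import Relation.Binary.PropositionalEquality using (_≡_)

-- A coloring of the pairs of [N] = {1,…,N} with integer colors.
-- χ u v is the color of the pair {u,v}; it is only ever consulted for u < v
-- (both in [N]), values outside are irrelevant.
Coloring : Set
Coloring = ℕ → ℕ → ℤ

NonIncTriple : Coloring → ℕ → ℕ → ℕ → Set
NonIncTriple χ u v w =
  (χ u v ≡ χ u w × χ v w ≤ℤ χ u w) ⊎ (χ v w ≤ℤ χ u v × χ v w ≡ χ u w)

-- S = {v_1 < … < v_s} ⊆ [N], given as a sequence v indexed by 1,…,s
-- (values at other indices are irrelevant).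
InRange : ℕ → ℕ → Set
InRange N x = 1 ≤ x × x ≤ N

IsIncreasingSubsetSeq : ℕ → ℕ → (ℕ → ℕ) → Set
IsIncreasingSubsetSeq N s v =
  (∀ a → 1 ≤ a → a ≤ s → InRange N (v a)) ×
  (∀ a b → 1 ≤ a → a < b → b ≤ s → v a < v b)

NonIncreasingSeq : Coloring → ℕ → (ℕ → ℕ) → Set
NonIncreasingSeq χ s v =
  ∀ a b c → 1 ≤ a → a < b → b < c → c ≤ s → NonIncTriple χ (v a) (v b) (v c)

{-# OPTIONS --safe #-}
module Submission where

open import Defs
open import Data.Nat using (ℕ; _<_; _≤_; _∸_; _+_; suc; s≤s; z≤n)
open import Data.Nat.Properties using (m≤n⇒m<n∨m≡n; m<m+n; +-comm; <-≤-trans; <⇒≤; n<1+n)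
open import Data.Integer using () renaming (_≤_ to _≤ℤ_)
open import Data.Integer.Properties using (≤-refl; ≤-reflexive)
open import Data.Product using (_×_; _,_)
open import Data.Sum using (inj₁; inj₂)
open import Relation.Binary.PropositionalEquality using (refl; sym; subst)

module _ (χ : Coloring) (u v w : ℕ) where

  nonIncTriple⇒χvw≤χuv : NonIncTriple χ u v w → χ v w ≤ℤ χ u v
  nonIncTriple⇒χvw≤χuv (inj₁ (χuv≡χuw , χvw≤χuw)) = subst (χ v w ≤ℤ_) (sym χuv≡χuw) χvw≤χuw
  nonIncTriple⇒χvw≤χuv (inj₂ (χvw≤χuv , _))       = χvw≤χuv

  nonIncTriple⇒χvw≤χuw : NonIncTriple χ u v w → χ v w ≤ℤ χ u w
  nonIncTriple⇒χvw≤χuw (inj₁ (_ , χvw≤χuw)) = χvw≤χuw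
  nonIncTriple⇒χvw≤χuw (inj₂ (_ , χvw≡χuw)) = ≤-reflexive χvw≡χuw

  nonIncTriple⇒χuw≤χuv : NonIncTriple χ u v w → χ u w ≤ℤ χ u v
  nonIncTriple⇒χuw≤χuv (inj₁ (χuv≡χuw , _))       = ≤-reflexive (sym χuv≡χuw)
  nonIncTriple⇒χuw≤χuv (inj₂ (χvw≤χuv , χvw≡χuw)) = subst (_≤ℤ χ u v) χvw≡χuw χvw≤χuv

module _ (χ : Coloring) (v : ℕ → ℕ) {s : ℕ} (nonInc : NonIncreasingSeq χ s v) where

  χ-antitoneˡ : ∀ {i k j} → 1 ≤ i → i ≤ k → k < j → j ≤ s →
                χ (v k) (v j) ≤ℤ χ (v i) (v j)
  χ-antitoneˡ {i} {k} {j} 1≤i i≤k k<j j≤s with m≤n⇒m<n∨m≡n i≤k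
  ... | inj₁ i<k  = nonIncTriple⇒χvw≤χuw χ (v i) (v k) (v j) (nonInc i k j 1≤i i<k k<j j≤s)
  ... | inj₂ refl = ≤-refl

  χ-antitoneʳ : ∀ {j k l} → 1 ≤ j → j < k → k ≤ l → l ≤ s →
                χ (v j) (v l) ≤ℤ χ (v j) (v k)
  χ-antitoneʳ {j} {k} {l} 1≤j j<k k≤l l≤s with m≤n⇒m<n∨m≡n k≤l
  ... | inj₁ k<l  = nonIncTriple⇒χuw≤χuv χ (v j) (v k) (v l) (nonInc j k l 1≤j j<k k<l l≤s)
  ... | inj₂ refl = ≤-refl

lemma2p1 : (N : ℕ) (χ : Coloring) (s : ℕ) (v : ℕ → ℕ) →
    IsIncreasingSubsetSeq N s v →
    NonIncreasingSeq χ s v →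
    (i j l : ℕ) → 1 ≤ i → i < j → j < l → l ≤ s →
    (χ (v j) (v l) ≤ℤ χ (v i) (v j)) ×
    (χ (v (j ∸ 1)) (v j) ≤ℤ χ (v i) (v j)) ×
    (χ (v j) (v l) ≤ℤ χ (v j) (v (j + 1)))
lemma2p1 N χ s v _ nonInc i (suc j) l 1≤i i<j@(s≤s i≤j) j<l l≤s =
    nonIncTriple⇒χvw≤χuv χ (v i) (v (suc j)) (v l) (nonInc i (suc j) l 1≤i i<j j<l l≤s)
  , χ-antitoneˡ χ v nonInc 1≤i i≤j (n<1+n j) (<⇒≤ (<-≤-trans j<l l≤s))
  , χ-antitoneʳ χ v nonInc (s≤s z≤n) (m<m+n (suc j) (s≤s z≤n)) j+1≤l l≤s
  where
  j+1≤l : suc j + 1 ≤ l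
  j+1≤l = subst (_≤ l) (+-comm 1 (suc j)) j<l
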